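{- Let $\{a_n\},\{b_n\},\{x_n\},\{y_n\}$ ($n\in\mathbb{Z}$) be sequences of complex numbers with $x_na_n+y_nb_n\neq 0$ for all $n$. Let $\{\alpha_{k,n}\}$ and $\{\beta_{k,n}\}$ ($k,n\in\mathbb{Z}$) satisfy $\beta_{n,k}=-\beta_{k,n}$ for all $n,k$ and $$\alpha_{k,n}=x_ka_n+y_kb_n,\qquad \beta_{n-1,n}=a_nb_{n-1}-a_{n-1}b_n\quad\text{for all }k,n.$$ Then $$\alpha_{n,p}\beta_{q,k}+\alpha_{n,q}\beta_{k,p}+\alpha_{n,k}\beta_{p,q}=0\quad\text{for all integers }n,k,p,q$$ holds if and only if $\beta_{k,n}=a_nb_k-a_kb_n$ for all integers $k,n$. -}

module Defs where

open import Level using (Level; _⊔_; suc)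
open import Algebra.Bundles using (CommutativeRing)
open import Relation.Nullary using (¬_)
open import Data.Product using (Σ; _×_)

record Field (c ℓ : Level) : Set (suc (c ⊔ ℓ)) where
  field
    commutativeRing : CommutativeRing c ℓ
  open CommutativeRing commutativeRing public
  field
    1≉0     : ¬ (1# ≈ 0#)
    inverse : ∀ x → ¬ (x ≈ 0#) → Σ Carrier (λ y → (x * y ≈ 1#) × (y * x ≈ 1#))

module Submission where

-- The minors β k n = a n b k - a k b n satisfy the relation because three vectors
-- (a p, b p), (a q, b q), (a k, b k) in a plane are linearly dependent with the minors as
-- coefficients.  Conversely, the relation with n = p expresses α p p β q k, where α p p ≠ 0,
-- through β k p and β p q; with n = k = p = q and antisymmetry it forces β q q = 0 in every
-- characteristic.  So two antisymmetric solutions that agree on the pairs (n - 1, n) agree on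
-- (m, m + d) by induction on d, hence everywhere.

open import Defs
open import Level using (Level; _⊔_)
open import Algebra.Bundles using (CommutativeRing)
open import Data.Integer as ℤ using (ℤ; 1ℤ)
import Data.Integer.Properties as ℤ
open import Data.Integer.Tactic.RingSolver using (solve-∀)
open import Data.Nat as ℕ using (ℕ)
open import Data.Product using (_,_; ∃-syntax)
open import Data.Sum using (_⊎_; inj₁; inj₂)
open import Function.Bundles using (_⇔_; mk⇔)
open import Relation.Binary.PropositionalEquality as ≡ using (_≡_)
open import Relation.Nullary using (¬_)
import Algebra.Properties.AbelianGroup as AbelianGroupProperties
import Algebra.Properties.CommutativeSemigroup as CommutativeSemigroupProperties
import Algebra.Properties.Ring as RingProperties
import Algebra.Solver.Ring.NaturalCoefficients.Default as SemiringSolver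
import Relation.Binary.Reasoning.Setoid as SetoidReasoning

n≡k+[n-k] : ∀ k n → n ≡ k ℤ.+ (n ℤ.- k)
n≡k+[n-k] = solve-∀

k≡n-[n-k] : ∀ k n → k ≡ n ℤ.+ ℤ.- (n ℤ.- k)
k≡n-[n-k] = solve-∀

≤-total-by-distance : ∀ k n → (∃[ d ] n ≡ k ℤ.+ ℤ.+ d) ⊎ (∃[ d ] k ≡ n ℤ.+ ℤ.+ d)
≤-total-by-distance k n with n ℤ.- k | n≡k+[n-k] k n | k≡n-[n-k] k n
... | ℤ.+ d      | n≡k+d | _     = inj₁ (d , n≡k+d)
... | ℤ.-[1+ d ] | _     | k≡n+d = inj₂ (ℕ.suc d , k≡n+d)

[i+[1+j]]-1≡i+j : ∀ i j → (i ℤ.+ (1ℤ ℤ.+ j)) ℤ.- 1ℤ ≡ i ℤ.+ j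
[i+[1+j]]-1≡i+j = solve-∀

module Minors {c ℓ : Level} (R : CommutativeRing c ℓ) where
  open CommutativeRing R
  open AbelianGroupProperties +-abelianGroup using (∙-cancelʳ; ⁻¹-anti-homo‿-)
  open CommutativeSemigroupProperties +-commutativeSemigroup using (interchange)
  open RingProperties ring using (x[y-z]≈xy-xz; -‿+-comm)
  open SemiringSolver commutativeSemiring using (solve; _:=_; _:+_; _:*_)
  open SetoidReasoning setoid

  ThreeTermRelation : ∀ {i} {I : Set i} (α β : I → I → Carrier) → Set (i ⊔ ℓ)
  ThreeTermRelation α β = ∀ n k p q → α n p * β q k + α n q * β k p + α n k * β p q ≈ 0#

  Antisymmetric : ∀ {i} {I : Set i} (β : I → I → Carrier) → Set (i ⊔ ℓ)
  Antisymmetric β = ∀ n k → β n k ≈ - β k n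

  +-cancel-≈0 : ∀ {u u′ v w} → u + v + w ≈ 0# → u′ + v + w ≈ 0# → u ≈ u′
  +-cancel-≈0 {u} {u′} {v} {w} e e′ =
    ∙-cancelʳ v u u′ (∙-cancelʳ w (u + v) (u′ + v) (trans e (sym e′)))

  [a-b]+[c-d]≈[a+c]-[b+d] : ∀ a b c d → (a - b) + (c - d) ≈ (a + c) - (b + d)
  [a-b]+[c-d]≈[a+c]-[b+d] a b c d = trans (interchange a (- b) c (- d)) (+-congˡ (-‿+-comm b d))

  minor : ∀ {i} {I : Set i} (a b : I → Carrier) → I → I → Carrier
  minor a b k n = a n * b k - a k * b n

  minor-antisymmetric : ∀ {i} {I : Set i} (a b : I → Carrier) → Antisymmetric (minor a b)
  minor-antisymmetric a b n k = sym (⁻¹-anti-homo‿- (a n * b k) (a k * b n))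

  threeTermRelation-respects : ∀ {i} {I : Set i} {α β β′ : I → I → Carrier} →
    (∀ k n → β k n ≈ β′ k n) → ThreeTermRelation α β′ → ThreeTermRelation α β
  threeTermRelation-respects β≈β′ H n k p q =
    trans (+-cong (+-cong (*-congˡ (β≈β′ q k)) (*-congˡ (β≈β′ k p))) (*-congˡ (β≈β′ p q)))
          (H n k p q)

  -- Splitting off the two sums of triple products leaves a subtraction-free identity,
  -- which the semiring solver proves.
  minor-threeTermRelation : ∀ {i} {I : Set i} (a b x y : I → Carrier) {α : I → I → Carrier} →
    (∀ k n → α k n ≈ x k * a n + y k * b n) → ThreeTermRelation α (minor a b)
  minor-threeTermRelation a b x y {α} α≈ n k p q = begin
    α n p * (a k * b q - a q * b k) + α n q * (a p * b k - a k * b p)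
      + α n k * (a q * b p - a p * b q)
      ≈⟨ +-cong (+-cong (x[y-z]≈xy-xz _ _ _) (x[y-z]≈xy-xz _ _ _)) (x[y-z]≈xy-xz _ _ _) ⟩
    (α n p * (a k * b q) - α n p * (a q * b k)) + (α n q * (a p * b k) - α n q * (a k * b p))
      + (α n k * (a q * b p) - α n k * (a p * b q))
      ≈⟨ trans (+-congʳ ([a-b]+[c-d]≈[a+c]-[b+d] _ _ _ _)) ([a-b]+[c-d]≈[a+c]-[b+d] _ _ _ _) ⟩
    positive - negative   ≈⟨ +-congʳ positive≈negative ⟩
    negative - negative   ≈⟨ -‿inverseʳ negative ⟩
    0#                    ∎
    where
    positive negative : Carrier
    positive = α n p * (a k * b q) + α n q * (a p * b k) + α n k * (a q * b p)
    negative = α n p * (a q * b k) + α n q * (a k * b p) + α n k * (a p * b q)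
    positive≈negative : positive ≈ negative
    positive≈negative = begin
      positive
        ≈⟨ +-cong (+-cong (*-congʳ (α≈ n p)) (*-congʳ (α≈ n q))) (*-congʳ (α≈ n k)) ⟩
      (x n * a p + y n * b p) * (a k * b q) + (x n * a q + y n * b q) * (a p * b k)
        + (x n * a k + y n * b k) * (a q * b p)
        ≈⟨ solve 8 (λ xn yn ap bp aq bq ak bk →
             (xn :* ap :+ yn :* bp) :* (ak :* bq) :+ (xn :* aq :+ yn :* bq) :* (ap :* bk)
               :+ (xn :* ak :+ yn :* bk) :* (aq :* bp)
             := (xn :* ap :+ yn :* bp) :* (aq :* bk) :+ (xn :* aq :+ yn :* bq) :* (ak :* bp)
               :+ (xn :* ak :+ yn :* bk) :* (ap :* bq))
             refl (x n) (y n) (a p) (b p) (a q) (b q) (a k) (b k) ⟩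
      (x n * a p + y n * b p) * (a q * b k) + (x n * a q + y n * b q) * (a k * b p)
        + (x n * a k + y n * b k) * (a p * b q)
        ≈⟨ +-cong (+-cong (*-congʳ (α≈ n p)) (*-congʳ (α≈ n q))) (*-congʳ (α≈ n k)) ⟨
      negative ∎

module _ {c ℓ : Level} (F : Field c ℓ) where
  open Field F
  open Minors commutativeRing
  open RingProperties ring using (-‿distribʳ-*)
  open SetoidReasoning setoid

  *-cancelˡ-nonzero : ∀ {u v w} → ¬ u ≈ 0# → u * v ≈ u * w → v ≈ w
  *-cancelˡ-nonzero {u} {v} {w} u≉0 uv≈uw with inverse u u≉0
  ... | u⁻¹ , _ , u⁻¹u≈1 = begin
    v              ≈⟨ *-identityˡ v ⟨
    1# * v         ≈⟨ *-congʳ u⁻¹u≈1 ⟨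
    u⁻¹ * u * v    ≈⟨ *-assoc u⁻¹ u v ⟩
    u⁻¹ * (u * v)  ≈⟨ *-congˡ uv≈uw ⟩
    u⁻¹ * (u * w)  ≈⟨ *-assoc u⁻¹ u w ⟨
    u⁻¹ * u * w    ≈⟨ *-congʳ u⁻¹u≈1 ⟩
    1# * w         ≈⟨ *-identityˡ w ⟩
    w              ∎

  -- No division by 2 is needed: the relation at (q, q, q, q) says 3 t ≈ 0 for t = α q q * β q q,
  -- while antisymmetry gives 2 t ≈ 0.
  antisymmetric-diagonal-zero : ∀ {i} {I : Set i} {α β : I → I → Carrier} →
    Antisymmetric β → ThreeTermRelation α β → ∀ q → ¬ α q q ≈ 0# → β q q ≈ 0#
  antisymmetric-diagonal-zero {α = α} {β} anti H q α≉0 =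
    *-cancelˡ-nonzero α≉0 (trans t≈0 (sym (zeroʳ (α q q))))
    where
    t : Carrier
    t = α q q * β q q
    t+t≈0 : t + t ≈ 0#
    t+t≈0 = begin
      t + t                  ≈⟨ +-congˡ (*-congˡ (anti q q)) ⟩
      t + α q q * - β q q    ≈⟨ +-congˡ (-‿distribʳ-* (α q q) (β q q)) ⟨
      t + - t                ≈⟨ -‿inverseʳ t ⟩
      0#                     ∎
    t≈0 : t ≈ 0#
    t≈0 = begin
      t            ≈⟨ +-identityˡ t ⟨
      0# + t       ≈⟨ +-congʳ t+t≈0 ⟨
      t + t + t    ≈⟨ H q q q q ⟩
      0#           ∎

  threeTermRelation-unique : {α β β′ : ℤ → ℤ → Carrier} → (∀ p → ¬ α p p ≈ 0#) →
    Antisymmetric β → Antisymmetric β′ → ThreeTermRelation α β → ThreeTermRelation α β′ →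
    (∀ n → β (n ℤ.- 1ℤ) n ≈ β′ (n ℤ.- 1ℤ) n) → ∀ k n → β k n ≈ β′ k n
  threeTermRelation-unique {α} {β} {β′} α≉0 anti anti′ H H′ consecutive = agree
    where
    swap : ∀ {k n} → β k n ≈ β′ k n → β n k ≈ β′ n k
    swap {k} {n} e = trans (anti n k) (trans (-‿cong e) (sym (anti′ n k)))

    determine : ∀ {p q k} → β k p ≈ β′ k p → β p q ≈ β′ p q → β q k ≈ β′ q k
    determine {p} {q} {k} e₁ e₂ = *-cancelˡ-nonzero (α≉0 p) (+-cancel-≈0 (H p k p q)
      (trans (+-cong (+-cong refl (*-congˡ e₁)) (*-congˡ e₂)) (H′ p k p q)))

    walk : ∀ d m → β m (m ℤ.+ ℤ.+ d) ≈ β′ m (m ℤ.+ ℤ.+ d)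
    walk ℕ.zero m rewrite ℤ.+-identityʳ m =
      trans (antisymmetric-diagonal-zero anti H m (α≉0 m))
            (sym (antisymmetric-diagonal-zero anti′ H′ m (α≉0 m)))
    walk (ℕ.suc d) m = determine (swap step) (swap (walk d m))
      where
      next : ℤ
      next = m ℤ.+ ℤ.+ ℕ.suc d
      step : β (m ℤ.+ ℤ.+ d) next ≈ β′ (m ℤ.+ ℤ.+ d) next
      step = ≡.subst (λ j → β j next ≈ β′ j next) ([i+[1+j]]-1≡i+j m (ℤ.+ d)) (consecutive next)

    agree : ∀ k n → β k n ≈ β′ k n
    agree k n with ≤-total-by-distance k n
    ... | inj₁ (d , ≡.refl) = walk d k
    ... | inj₂ (d , ≡.refl) = swap (walk d n)

corollary3p7 : {c ℓ : Level} (F : Field c ℓ) → let open Field F in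
    (a b x y : ℤ → Carrier) →
    (∀ n → ¬ (x n * a n + y n * b n ≈ 0#)) →
    (α β : ℤ → ℤ → Carrier) →
    (∀ n k → β n k ≈ - β k n) →
    (∀ k n → α k n ≈ x k * a n + y k * b n) →
    (∀ n → β (n ℤ.- 1ℤ) n ≈ a n * b (n ℤ.- 1ℤ) - a (n ℤ.- 1ℤ) * b n) →
    ((∀ n k p q → α n p * β q k + α n q * β k p + α n k * β p q ≈ 0#)
    ⇔ (∀ k n → β k n ≈ a n * b k - a k * b n))
corollary3p7 F a b x y diagonal≉0 α β anti α≈ consecutive =
  mk⇔ (λ H → threeTermRelation-unique F α≉0 anti (minor-antisymmetric a b) H minor-relation consecutive)
      (λ β≈minor → threeTermRelation-respects β≈minor minor-relation)
  where
  open Field F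
  open Minors commutativeRing
  minor-relation : ThreeTermRelation α (minor a b)
  minor-relation = minor-threeTermRelation a b x y α≈
  α≉0 : ∀ p → ¬ α p p ≈ 0#
  α≉0 p αpp≈0 = diagonal≉0 p (trans (sym (α≈ p p)) αpp≈0)
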